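{- For any zigzag strategy with defining sequence $(u_i)_{i\ge0}$ and known initial distance $d\ge1$, for all $i\ge0$, $s_i\le 2^{i+1}\, d\prod_{j=0}^{i}u_j$.
   Context: Search model: a robot starts at the origin of the real line at time $0$ with maximum speed $1$. A target starts at distance $d\ge1$ from the origin (on one of two sides) and moves away from the origin at constant speed $v\in[0,1)$; its evasiveness is $u=\frac1{1-v}$, $v=1-\frac1u$. A zigzag strategy is given by a sequence $(u_i)_{i\ge0}$ of evasiveness values ($u_i\ge1$) with $u_{i+2}>u_i$ for all $i\ge0$ and $u_i\to\infty$; the motion is divided into rounds $i=0,1,2,\dots$: in round $i$ the robot travels at speed $1$ from the origin to position $(-1)^i x_i$ and back to the origin, where $x_i$ is the distance just large enough to catch the target of evasiveness $u_i$ on side $(-1)^i$. Set $s_i=\sum_{n=0}^i x_n$ for $i\ge -1$ (so $s_{ -1}=0$). -}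

module Defs where

open import Level using (Level; suc; _⊔_)
open import Data.Nat as ℕ using (ℕ; zero) renaming (suc to sucℕ)
open import Data.Product using (∃)
open import Relation.Nullary using (¬_)
open import Relation.Binary.Structures using (IsTotalOrder)
open import Algebra.Bundles using (CommutativeRing)

-- An ordered commutative ring (the reals ℝ are an instance).
-- The standard library has no real numbers and no ordered rings, so we
-- state the result for an arbitrary ordered commutative ring.
record OrderedCommutativeRing (c ℓ₁ ℓ₂ : Level) : Set (suc (c ⊔ ℓ₁ ⊔ ℓ₂)) where
  field
    commutativeRing : CommutativeRing c ℓ₁
  open CommutativeRing commutativeRing public
  infix 4 _≤_
  field
    _≤_            : Carrier → Carrier → Set ℓ₂
    isTotalOrder   : IsTotalOrder _≈_ _≤_
    +-monoʳ-≤      : ∀ {x y} z → x ≤ y → x + z ≤ y + z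
    *-nonneg       : ∀ {x y} → 0# ≤ x → 0# ≤ y → 0# ≤ x * y

  infix 4 _<_
  _<_ : Carrier → Carrier → Set (ℓ₁ ⊔ ℓ₂)
  x < y = (x ≤ y) × ¬ (x ≈ y)
    where open import Data.Product using (_×_)

module Zigzag {c ℓ₁ ℓ₂} (R : OrderedCommutativeRing c ℓ₁ ℓ₂) where
  open OrderedCommutativeRing R

  two : Carrier
  two = 1# + 1#

  pow2 : ℕ → Carrier
  pow2 zero     = 1#
  pow2 (sucℕ n) = two * pow2 n

  prodU : (ℕ → Carrier) → ℕ → Carrier
  prodU u zero     = u 0
  prodU u (sucℕ i) = prodU u i * u (sucℕ i)

  record IsZigzagSequence (u : ℕ → Carrier) : Set (c ⊔ ℓ₁ ⊔ ℓ₂) where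
    field
      u≥1        : ∀ i → 1# ≤ u i
      increasing : ∀ i → u i < u (sucℕ (sucℕ i))
      divergent  : ∀ M → ∃ λ N → ∀ i → N ℕ.≤ i → M ≤ u i

  -- prevSum u d i = s_{i-1}  (so prevSum u d 0 = s_{-1} = 0), and
  -- turn u d i = x_i, the turning distance of round i.
  -- Round i starts at the origin at time 2 s_{i-1}; the robot reaches
  -- distance x at time 2 s_{i-1} + x, while the target of speed
  -- v_i = 1 - 1/u_i is at d + v_i (2 s_{i-1} + x).  The smallest x
  -- catching it solves (1 - v_i) x = d + 2 v_i s_{i-1}, i.e.
  --   x_i = u_i d + 2 (u_i - 1) s_{i-1}.
  prevSum : (ℕ → Carrier) → Carrier → ℕ → Carrier
  turn    : (ℕ → Carrier) → Carrier → ℕ → Carrier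
  prevSum u d zero     = 0#
  prevSum u d (sucℕ i) = prevSum u d i + turn u d i
  turn u d i = u i * d + two * (u i - 1#) * prevSum u d i

  s : (ℕ → Carrier) → Carrier → ℕ → Carrier
  s u d i = prevSum u d (sucℕ i)

{-# OPTIONS --safe #-}
-- Proof idea: since x_i = u_i d + 2 (u_i - 1) s_{i-1}, we get
--   2 u_i (d + s_{i-1}) - (d + s_i) = (u_i - 1) d + s_{i-1} ≥ 0,
-- so d + s_i ≤ 2 u_i (d + s_{i-1}) with d + s_{-1} = d; iterating gives
-- s_i ≤ d + s_i ≤ 2^{i+1} d ∏_{j≤i} u_j.
module Submission where

open import Defs
open import Data.Nat using (ℕ; zero; suc)
open import Data.Sum using (inj₁; inj₂)
open import Relation.Binary.Bundles using (Poset)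
open import Relation.Binary.Structures using (IsTotalOrder)
import Algebra.Properties.Ring as RingProperties
import Algebra.Solver.Ring.NaturalCoefficients.Default as SemiringSolver
import Relation.Binary.Reasoning.PartialOrder as PartialOrderReasoning

module OrderedCommutativeRingProperties
  {c ℓ₁ ℓ₂} (R : OrderedCommutativeRing c ℓ₁ ℓ₂) where

  open OrderedCommutativeRing R
  open RingProperties ring using (-‿distribˡ-*; -‿distribʳ-*; -‿involutive; //-rightDividesˡ; x[y-z]≈xy-xz)
  open IsTotalOrder isTotalOrder public
    using (total; ≤-respˡ-≈; ≤-respʳ-≈) renaming (trans to ≤-trans; reflexive to ≤-reflexive)

  poset : Poset c ℓ₁ ℓ₂
  poset = record { isPartialOrder = IsTotalOrder.isPartialOrder isTotalOrder }

  module ≤-Reasoning = PartialOrderReasoning poset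

  x≤y⇒0≤y-x : ∀ {x y} → x ≤ y → 0# ≤ y - x
  x≤y⇒0≤y-x {x} h = ≤-respˡ-≈ (-‿inverseʳ x) (+-monoʳ-≤ (- x) h)

  0≤y-x⇒x≤y : ∀ {x y} → 0# ≤ y - x → x ≤ y
  0≤y-x⇒x≤y {x} {y} h = ≤-respʳ-≈ (//-rightDividesˡ x y) (≤-respˡ-≈ (+-identityˡ x) (+-monoʳ-≤ x h))

  x≤y+x : ∀ {x y} → 0# ≤ y → x ≤ y + x
  x≤y+x {x} h = ≤-respˡ-≈ (+-identityˡ x) (+-monoʳ-≤ x h)

  x≤x+y : ∀ {x y} → 0# ≤ y → x ≤ x + y
  x≤x+y {x} {y} h = ≤-respʳ-≈ (+-comm y x) (x≤y+x h)

  +-nonneg : ∀ {x y} → 0# ≤ x → 0# ≤ y → 0# ≤ x + y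
  +-nonneg hx hy = ≤-trans hx (x≤x+y hy)

  *-monoˡ-≤-nonneg : ∀ {x y z} → 0# ≤ z → x ≤ y → z * x ≤ z * y
  *-monoˡ-≤-nonneg {x} {y} {z} hz h =
    0≤y-x⇒x≤y (≤-respʳ-≈ (x[y-z]≈xy-xz z y x) (*-nonneg hz (x≤y⇒0≤y-x h)))

  x*x-nonneg : ∀ x → 0# ≤ x * x
  x*x-nonneg x with total 0# x
  ... | inj₁ 0≤x = *-nonneg 0≤x 0≤x
  ... | inj₂ x≤0 = ≤-respʳ-≈ -x*-x≈x*x (*-nonneg 0≤-x 0≤-x)
    where
    0≤-x : 0# ≤ - x
    0≤-x = ≤-respʳ-≈ (+-identityˡ (- x)) (x≤y⇒0≤y-x x≤0)
    -x*-x≈x*x : - x * - x ≈ x * x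
    -x*-x≈x*x = trans (sym (-‿distribˡ-* x (- x)))
                      (trans (-‿cong (sym (-‿distribʳ-* x x))) (-‿involutive (x * x)))

  0≤1 : 0# ≤ 1#
  0≤1 = ≤-respʳ-≈ (*-identityˡ 1#) (x*x-nonneg 1#)

  x≈1+[x-1] : ∀ x → x ≈ 1# + (x - 1#)
  x≈1+[x-1] x = trans (sym (//-rightDividesˡ 1# x)) (+-comm (x - 1#) 1#)

module ZigzagProperties {c ℓ₁ ℓ₂} (R : OrderedCommutativeRing c ℓ₁ ℓ₂) where

  open OrderedCommutativeRing R
  open Zigzag R
  open OrderedCommutativeRingProperties R
  open SemiringSolver commutativeSemiring using (solve; _:=_; _:+_; _:*_; con)

  0≤two : 0# ≤ two
  0≤two = +-nonneg 0≤1 0≤1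

  pow2-prodU-suc : ∀ u d i →
    pow2 (suc (suc i)) * d * prodU u (suc i) ≈ two * u (suc i) * (pow2 (suc i) * d * prodU u i)
  pow2-prodU-suc u d i = solve 5
    (λ t p d P U → t :* p :* d :* (P :* U) := t :* U :* (p :* d :* P))
    refl two (pow2 (suc i)) d (prodU u i) (u (suc i))

  module _ {u : ℕ → Carrier} {d : Carrier} (u≥1 : ∀ i → 1# ≤ u i) (0≤d : 0# ≤ d) where

    0≤u : ∀ i → 0# ≤ u i
    0≤u i = ≤-trans 0≤1 (u≥1 i)

    prevSum-nonneg : ∀ i → 0# ≤ prevSum u d i
    prevSum-nonneg zero    = ≤-reflexive refl
    prevSum-nonneg (suc i) =
      +-nonneg 0≤S (+-nonneg (*-nonneg (0≤u i) 0≤d) (*-nonneg (*-nonneg 0≤two (x≤y⇒0≤y-x (u≥1 i))) 0≤S))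
      where
      0≤S : 0# ≤ prevSum u d i
      0≤S = prevSum-nonneg i

    d+prevSum-suc≤ : ∀ i → d + prevSum u d (suc i) ≤ two * u i * (d + prevSum u d i)
    d+prevSum-suc≤ i = begin
      d + prevSum u d (suc i)                                  ≡⟨⟩
      d + (S + (U * d + two * a * S))                          ≈⟨ +-congˡ (+-congˡ (+-congʳ (*-congʳ (x≈1+[x-1] U)))) ⟩
      d + (S + ((1# + a) * d + two * a * S))                   ≤⟨ x≤x+y (+-nonneg (*-nonneg 0≤a 0≤d) 0≤S) ⟩
      d + (S + ((1# + a) * d + two * a * S)) + (a * d + S)     ≈⟨ surplus-identity a d S ⟩
      two * (1# + a) * (d + S)                                 ≈⟨ *-congʳ (*-congˡ (x≈1+[x-1] U)) ⟨
      two * U * (d + S)                                        ∎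
      where
      open ≤-Reasoning
      U a S : Carrier
      U = u i
      a = U - 1#
      S = prevSum u d i
      0≤a : 0# ≤ a
      0≤a = x≤y⇒0≤y-x (u≥1 i)
      0≤S : 0# ≤ S
      0≤S = prevSum-nonneg i
      -- U is written as 1 + a because the solver only knows natural coefficients.
      surplus-identity : ∀ a d S →
        d + (S + ((1# + a) * d + two * a * S)) + (a * d + S) ≈ two * (1# + a) * (d + S)
      surplus-identity = solve 3
        (λ a d S → let two = con 1 :+ con 1 in
           d :+ (S :+ ((con 1 :+ a) :* d :+ two :* a :* S)) :+ (a :* d :+ S) := two :* (con 1 :+ a) :* (d :+ S))
        refl

    d+s≤pow2*d*prodU : ∀ i → d + s u d i ≤ pow2 (suc i) * d * prodU u i
    d+s≤pow2*d*prodU zero = ≤-respʳ-≈ base-identity (d+prevSum-suc≤ 0)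
      where
      base-identity : two * u 0 * (d + 0#) ≈ (two * 1#) * d * u 0
      base-identity = solve 3 (λ t U d → t :* U :* (d :+ con 0) := t :* con 1 :* d :* U) refl two (u 0) d
    d+s≤pow2*d*prodU (suc i) = begin
      d + s u d (suc i)                                  ≤⟨ d+prevSum-suc≤ (suc i) ⟩
      two * u (suc i) * (d + s u d i)                    ≤⟨ *-monoˡ-≤-nonneg 0≤2u (d+s≤pow2*d*prodU i) ⟩
      two * u (suc i) * (pow2 (suc i) * d * prodU u i)   ≈⟨ pow2-prodU-suc u d i ⟨
      pow2 (suc (suc i)) * d * prodU u (suc i)           ∎
      where
      open ≤-Reasoning
      0≤2u : 0# ≤ two * u (suc i)
      0≤2u = *-nonneg 0≤two (0≤u (suc i))

lemma7 : ∀ {c ℓ₁ ℓ₂} (R : OrderedCommutativeRing c ℓ₁ ℓ₂) →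
    let open OrderedCommutativeRing R
        open Zigzag R
    in (u : ℕ → Carrier) → IsZigzagSequence u →
       (d : Carrier) → 1# ≤ d →
       ∀ i → s u d i ≤ pow2 (suc i) * d * prodU u i
lemma7 R u zz d 1≤d i = ≤-trans (x≤y+x 0≤d) (d+s≤pow2*d*prodU (IsZigzagSequence.u≥1 zz) 0≤d i)
  where
  open OrderedCommutativeRing R
  open OrderedCommutativeRingProperties R
  open Zigzag R using (module IsZigzagSequence)
  open ZigzagProperties R
  0≤d : 0# ≤ d
  0≤d = ≤-trans 0≤1 1≤d
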